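{- Let $n,s$ be positive integers with $1 \leq s < \frac{n}{2}$, and let $M$ be a multiset of size $n$. Let $A$ be the set of all distinct permutations of $M$ (i.e. all distinct strings of length $n$ whose multiset of letters is $M$). Then there exists an $s$-overlap cycle on $A$.
   Context: For a finite set $\mathcal{C}$ of strings, each of length $n$, and an integer $1 \le s < n$, an $s$-overlap cycle ($s$-ocycle) on $\mathcal{C}$ is a cyclic ordering $c^{(1)}, c^{(2)}, \ldots, c^{(N)}$ of all elements of $\mathcal{C}$, each appearing exactly once, such that for every $j$ (indices taken cyclically, so $c^{(N)}$ is followed by $c^{(1)}$), the last $s$ letters of $c^{(j)}$ equal the first $s$ letters of $c^{(j+1)}$; that is, if $a=a_1\ldots a_n$ is followed by $b=b_1\ldots b_n$ then $a_{n-s+1}a_{n-s+2}\ldots a_n = b_1 b_2\ldots b_s$. -}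

module Defs where

open import Data.Nat using (ℕ; _∸_)
open import Data.List using (List; []; _∷_; length; take; drop)
open import Data.List.Relation.Unary.Unique.Propositional using (Unique)
open import Data.List.Membership.Propositional using (_∈_)
open import Data.List.Relation.Binary.Permutation.Propositional using (_↭_)
open import Data.Product using (_×_)
open import Relation.Binary.PropositionalEquality using (_≡_)
open import Function.Bundles using (_⇔_)

Str : Set
Str = List ℕ

-- The set A of distinct permutations of the multiset M (given as a list m,
-- whose order is irrelevant): all strings whose letters form the multiset m.
IsPermOf : Str → Str → Set
IsPermOf m w = w ↭ m

-- s-overlap of a followed by b (strings of length n): the last s letters of a
-- equal the first s letters of b.
Overlap : ℕ → ℕ → Str → Str → Set
Overlap n s a b = drop (n ∸ s) a ≡ take s b

data ChainFrom (R : Str → Str → Set) (first : Str) : Str → List Str → Set where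
  close : ∀ {x} → R x first → ChainFrom R first x []
  step  : ∀ {x y ys} → R x y → ChainFrom R first y ys → ChainFrom R first x (y ∷ ys)

data CyclicallyLinked (R : Str → Str → Set) : List Str → Set where
  cyc : ∀ {x xs} → ChainFrom R x x xs → CyclicallyLinked R (x ∷ xs)

IsOCycle : ℕ → ℕ → (Str → Set) → List Str → Set
IsOCycle n s P cs =
  Unique cs × (∀ w → (w ∈ cs) ⇔ P w) × CyclicallyLinked (Overlap n s) cs

module Submission where

-- Let σ rotate a word of length n to the left by n ∸ s letters. Then the last s
-- letters of w are the first s letters of σ w, so every σ-orbit, listed in order,
-- is an s-overlap cycle. Two such cycles can be merged: if a lies on the first,
-- b on the second, and a and b end with the same s letters, the orbit of b is
-- spliced in right after a. Starting from the orbit of m we absorb every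
-- rearrangement of m along a chain of adjacent transpositions from m. An adjacent
-- transposition u ↦ v either leaves the last s letters alone, so u and v end
-- alike, or (as 2s < n) it leaves alone the last s letters of ρ u, ρ v, where
-- ρ = σ⁻¹ is rotation by s; then ρ v is absorbed next to ρ u.

open import Defs
import Data.Nat as ℕ
open import Data.Nat using (ℕ; zero; suc; _+_; _*_; _∸_; _≤_; _<_; z≤n; s≤s; s≤s⁻¹)
open import Data.Nat.Properties using (m≤n⇒m<n∨m≡n; ≤-refl; ≤-trans; n≤1+n; m+[n∸m]≡n; m≤n⇒m⊓n≡m; m∸n≤m; m∸[m∸n]≡n; *-comm;
         m+n≤o⇒m≤o; m+n≤o⇒m≤o∸n; +-identityʳ; <⇒≤; <-≤-trans; ≰⇒>; +-∸-assoc; ∸-monoˡ-≤; _≤?_; module ≤-Reasoning)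
open import Data.Nat.GeneralisedArithmetic using (iterate)
open import Data.List using (List; []; _∷_; _++_; _∷ʳ_; length; take; drop; map; concatMap)
open import Data.List.Properties using (≡-dec; ++-assoc; ++-identityʳ; ∷ʳ-injective; take++drop≡id; length-take; length-drop)
open import Data.List.Membership.Propositional using (_∈_; _∉_; find; lose)
open import Data.List.Membership.Propositional.Properties
  using (∈-map⁺; ∈-map⁻; ∈-∃++; ∈-concatMap⁺; ∈-concatMap⁻; ∈-++⁺ˡ; ∈-++⁺ʳ; ∈-++⁻)
open import Data.List.Relation.Unary.Any using (here; there)
open import Data.List.Relation.Unary.All using (_∷_)
import Data.List.Relation.Unary.All as All
open import Data.List.Relation.Unary.AllPairs using ([]; _∷_)
open import Data.List.Relation.Unary.Unique.Propositional using (Unique)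
import Data.List.Relation.Unary.Unique.Propositional.Properties as Unique
open import Data.List.Relation.Binary.Permutation.Setoid.Properties using (Unique-resp-↭)
open import Data.List.Relation.Binary.Disjoint.Propositional using (Disjoint)
open import Data.List.Relation.Binary.Subset.Propositional using (_⊆_)
open import Data.List.Relation.Binary.Subset.Propositional.Properties using (⊆-refl; ⊆-trans)
open import Data.List.Membership.DecPropositional (≡-dec ℕ._≟_) using (_∈?_)
open import Data.List.Relation.Binary.Permutation.Propositional
  using (_↭_; ↭-refl; ↭-prep; ↭-swap; ↭-trans; ↭-sym; ↭⇒↭ₛ)
import Data.List.Relation.Binary.Permutation.Propositional as ↭
open import Data.List.Relation.Binary.Permutation.Propositional.Properties
  using (++-comm; ∷↭∷ʳ; ↭-length; ++⁺ˡ; ∈-resp-↭; drop-mid; ↭-empty-inv)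
open import Relation.Binary.Construct.Closure.ReflexiveTransitive using (Star; ε; _◅_; _◅◅_; gmap)
open import Data.Product using (Σ; ∃-syntax; _×_; _,_; proj₁; proj₂)
open import Data.Sum using (_⊎_; inj₁; inj₂; [_,_])
open import Function using (_∘_; mk⇔)
open import Relation.Nullary using (¬_; Dec; yes; no; contradiction)
open import Relation.Unary using (Decidable)
open import Relation.Binary.Definitions using (DecidableEquality)
open import Relation.Binary.PropositionalEquality
  using (_≡_; _≢_; refl; sym; trans; cong; subst; setoid; module ≡-Reasoning)

module _ {A : Set} (f : A → A) where

  iterate-+ : ∀ x a b → iterate f x (a + b) ≡ iterate f (iterate f x a) b
  iterate-+ x zero    b = refl
  iterate-+ x (suc a) b = iterate-+ (f x) a b

  iterate-commute : ∀ x k → iterate f (f x) k ≡ f (iterate f x k)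
  iterate-commute x zero    = refl
  iterate-commute x (suc k) = iterate-commute (f x) k

  iterate-* : ∀ x a b → iterate (λ y → iterate f y a) x b ≡ iterate f x (b * a)
  iterate-* x a zero    = refl
  iterate-* x a (suc b) = trans (iterate-* (iterate f x a) a b) (sym (iterate-+ x a (b * a)))

  iterate-fixed : ∀ {x} → f x ≡ x → ∀ k → iterate f x k ≡ x
  iterate-fixed fx≡x zero    = refl
  iterate-fixed {x} fx≡x (suc k) = trans (cong (λ y → iterate f y k) fx≡x) (iterate-fixed {x} fx≡x k)

  iterate-preserves : {P : A → Set} → (∀ {y} → P y → P (f y)) → ∀ {x} → P x → ∀ k → P (iterate f x k)
  iterate-preserves pres px zero    = px
  iterate-preserves {P} pres {x} px (suc k) = iterate-preserves {P} pres (pres {x} px) k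

  iterate-injective : (∀ {x y} → f x ≡ f y → x ≡ y) →
                      ∀ {x y} k → iterate f x k ≡ iterate f y k → x ≡ y
  iterate-injective inj zero    eq = eq
  iterate-injective inj (suc k) eq = inj (iterate-injective inj k eq)

Least : (ℕ → Set) → Set
Least P = ∃[ k ] (P k × ∀ {j} → j < k → ¬ P j)

module _ {P : ℕ → Set} (P? : Decidable P) where

  search : ∀ N → (∀ {j} → j < N → ¬ P j) ⊎ Least P
  search zero = inj₁ λ ()
  search (suc N) with search N
  ... | inj₂ least = inj₂ least
  ... | inj₁ none with P? N
  ...   | yes pN = inj₂ (N , pN , none)
  ...   | no ¬pN = inj₁ below
    where
    below : ∀ {j} → j < suc N → ¬ P j
    below j<1+N with m≤n⇒m<n∨m≡n (s≤s⁻¹ j<1+N)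
    ... | inj₁ j<N  = none j<N
    ... | inj₂ refl = ¬pN

  least-witness : ∀ {N} → P N → Least P
  least-witness {N} pN with search (suc N)
  ... | inj₁ none  = contradiction pN (none ≤-refl)
  ... | inj₂ least = least

data Path {A : Set} (R : A → A → Set) : A → List A → A → Set where
  []  : ∀ {x} → Path R x [] x
  _∷_ : ∀ {x y ys z} → R x y → Path R y ys z → Path R x (y ∷ ys) z

path-close : ∀ {R first d D e} → Path R d D e → R e first → ChainFrom R first d D
path-close []       e→first = close e→first
path-close (r ∷ p)  e→first = step r (path-close p e→first)

path-then-chain : ∀ {R first d D e y ys} →
                  Path R d D e → R e y → ChainFrom R first y ys → ChainFrom R first d (D ++ y ∷ ys)
path-then-chain []      e→y ch = step e→y ch
path-then-chain (r ∷ p) e→y ch = step r (path-then-chain p e→y ch)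

splice : ∀ {R first x ys a d D e} →
         ChainFrom R first x ys → a ∈ x ∷ ys → Path R d D e → R a d → (∀ {c} → R a c → R e c) →
         ∃[ ys′ ] (ys′ ↭ ys ++ d ∷ D × ChainFrom R first x ys′)
splice {ys = []}     {d = d} {D} (close x→first) (here refl) p a→d a⇒e =
  d ∷ D , ↭-refl , step a→d (path-close p (a⇒e x→first))
splice {ys = y ∷ ys} {d = d} {D} (step x→y ch)   (here refl) p a→d a⇒e =
  d ∷ D ++ y ∷ ys , ++-comm (d ∷ D) (y ∷ ys) , step a→d (path-then-chain p (a⇒e x→y) ch)
splice (step x→y ch) (there a∈) p a→d a⇒e with splice ch a∈ p a→d a⇒e
... | ys′ , ys′↭ , ch′ = _ ∷ ys′ , ↭-prep _ ys′↭ , step x→y ch′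

module Orbits {A : Set} (_≟_ : DecidableEquality A) (f : A → A)
              (f-injective : ∀ {x y} → f x ≡ f y → x ≡ y) where

  trajectory : ℕ → A → List A
  trajectory zero    x = []
  trajectory (suc j) x = f x ∷ trajectory j (f x)

  ∈-trajectory⁻ : ∀ j x {w} → w ∈ trajectory j x → ∃[ q ] (q < j × w ≡ iterate f x (suc q))
  ∈-trajectory⁻ (suc j) x (here refl) = 0 , s≤s z≤n , refl
  ∈-trajectory⁻ (suc j) x (there w∈) with ∈-trajectory⁻ j (f x) w∈
  ... | q , q<j , refl = suc q , s≤s q<j , refl

  ∈-trajectory⁺ : ∀ j x {q} → q < j → iterate f x (suc q) ∈ trajectory j x
  ∈-trajectory⁺ (suc j) x {zero}  _         = here refl
  ∈-trajectory⁺ (suc j) x {suc q} (s≤s q<j) = there (∈-trajectory⁺ j (f x) q<j)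

  NoReturn : ℕ → A → Set
  NoReturn k x = ∀ {q} → q < k → iterate f x (suc q) ≢ x

  noReturn-f : ∀ {k x} → NoReturn k x → NoReturn k (f x)
  noReturn-f {x = x} noRet {q} q<k eq =
    noRet q<k (f-injective (trans (sym (iterate-commute f x (suc q))) eq))

  trajectory-unique : ∀ {k} j x → NoReturn k x → j ≤ suc k → Unique (trajectory j x)
  trajectory-unique zero    x noRet j≤ = []
  trajectory-unique (suc j) x noRet (s≤s j≤k) =
    All.tabulate head-fresh ∷ trajectory-unique j (f x) (noReturn-f noRet) (≤-trans j≤k (n≤1+n _))
    where
    head-fresh : ∀ {w} → w ∈ trajectory j (f x) → f x ≢ w
    head-fresh w∈ fx≡w with ∈-trajectory⁻ j (f x) w∈
    ... | q , q<j , refl =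
      noRet (≤-trans q<j j≤k) (sym (f-injective (trans fx≡w (iterate-commute f x (suc q)))))

  -- The orbit of x: its least period is suc period.
  record Orbit (x : A) : Set where
    field
      period  : ℕ
      returns : iterate f x (suc period) ≡ x
      minimal : NoReturn period x

    elements : List A
    elements = trajectory (suc period) x

    path : ∀ {R : A → A → Set} {P : A → Set} → (∀ {y} → P y → P (f y)) →
           (∀ {y} → P y → R y (f y)) → P x → Path R (f x) (trajectory period (f x)) x
    path {R} {P} pres edge px = subst (Path R (f x) _) returns (walk period (pres px))
      where
      walk : ∀ j {y} → P y → Path R y (trajectory j y) (iterate f y j)
      walk zero    py = []
      walk (suc j) py = edge py ∷ walk j (pres py)

    unique : Unique elements
    unique = trajectory-unique (suc period) x minimal ≤-refl

    x∈ : x ∈ elements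
    x∈ = subst (_∈ elements) returns (∈-trajectory⁺ (suc period) x ≤-refl)

    closed : ∀ {w} → w ∈ elements → f w ∈ elements
    closed w∈ with ∈-trajectory⁻ (suc period) x w∈
    ... | q , q≤p , refl with m≤n⇒m<n∨m≡n (s≤s⁻¹ q≤p)
    ...   | inj₁ q<p  = subst (_∈ elements) (iterate-commute f x (suc q)) (∈-trajectory⁺ _ x (s≤s q<p))
    ...   | inj₂ refl = subst (λ y → f y ∈ elements) (sym returns) (here refl)

    invariant : ∀ {P : A → Set} → (∀ {y} → P y → P (f y)) → P x → ∀ {w} → w ∈ elements → P w
    invariant {P} pres px w∈ with ∈-trajectory⁻ (suc period) x w∈
    ... | q , _ , refl = iterate-preserves f {P} pres {x} px (suc q)

    leads-back : ∀ {w} → w ∈ elements → ∃[ k ] (iterate f w k ≡ x)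
    leads-back w∈ with ∈-trajectory⁻ (suc period) x w∈
    ... | q , q≤p , refl = period ∸ q , (begin
        iterate f (iterate f x (suc q)) (period ∸ q) ≡⟨ sym (iterate-+ f x (suc q) (period ∸ q)) ⟩
        iterate f x (suc q + (period ∸ q))           ≡⟨ cong (iterate f x ∘ suc) (m+[n∸m]≡n (s≤s⁻¹ q≤p)) ⟩
        iterate f x (suc period)                     ≡⟨ returns ⟩
        x                                            ∎)
      where open ≡-Reasoning

  orbit : ∀ {x} N → iterate f x (suc N) ≡ x → Orbit x
  orbit {x} N returns-N with least-witness (λ q → iterate f x (suc q) ≟ x) {N} returns-N
  ... | p , returns-p , below = record { period = p ; returns = returns-p ; minimal = below }

rotl : Str → Str
rotl []      = []
rotl (x ∷ w) = w ∷ʳ x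

rotl-↭ : ∀ w → rotl w ↭ w
rotl-↭ []      = ↭-refl
rotl-↭ (x ∷ w) = ↭-sym (∷↭∷ʳ x w)

rotl-injective : ∀ {u v} → rotl u ≡ rotl v → u ≡ v
rotl-injective {[]}    {[]}        _  = refl
rotl-injective {[]}    {y ∷ []}    ()
rotl-injective {[]}    {y ∷ _ ∷ _} ()
rotl-injective {x ∷ []}    {[]} ()
rotl-injective {x ∷ _ ∷ _} {[]} ()
rotl-injective {x ∷ u} {y ∷ v} eq with ∷ʳ-injective u v eq
... | refl , refl = refl

rotl-++ : ∀ xs ys → iterate rotl (xs ++ ys) (length xs) ≡ ys ++ xs
rotl-++ []       ys = sym (++-identityʳ ys)
rotl-++ (x ∷ xs) ys = begin
  iterate rotl ((xs ++ ys) ∷ʳ x) (length xs) ≡⟨ cong (λ w → iterate rotl w (length xs)) (++-assoc xs ys (x ∷ [])) ⟩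
  iterate rotl (xs ++ ys ∷ʳ x) (length xs)   ≡⟨ rotl-++ xs (ys ∷ʳ x) ⟩
  (ys ∷ʳ x) ++ xs                            ≡⟨ ++-assoc ys (x ∷ []) xs ⟩
  ys ++ x ∷ xs                               ∎
  where open ≡-Reasoning

rotl-length : ∀ w → iterate rotl w (length w) ≡ w
rotl-length w = begin
  iterate rotl w (length w)        ≡⟨ cong (λ v → iterate rotl v (length w)) (sym (++-identityʳ w)) ⟩
  iterate rotl (w ++ []) (length w) ≡⟨ rotl-++ w [] ⟩
  w                                 ∎
  where open ≡-Reasoning

rotl-prefix : ∀ k xs ys → k ≤ length xs → iterate rotl (xs ++ ys) k ≡ drop k xs ++ ys ++ take k xs
rotl-prefix k xs ys k≤ = begin
  iterate rotl (xs ++ ys) k                             ≡⟨ cong (λ w → iterate rotl (w ++ ys) k) (sym (take++drop≡id k xs)) ⟩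
  iterate rotl ((take k xs ++ drop k xs) ++ ys) k       ≡⟨ cong (λ w → iterate rotl w k) (++-assoc (take k xs) (drop k xs) ys) ⟩
  iterate rotl (take k xs ++ drop k xs ++ ys) k         ≡⟨ cong (iterate rotl _) (sym |take|≡k) ⟩
  iterate rotl (take k xs ++ drop k xs ++ ys) (length (take k xs)) ≡⟨ rotl-++ (take k xs) (drop k xs ++ ys) ⟩
  (drop k xs ++ ys) ++ take k xs                        ≡⟨ ++-assoc (drop k xs) ys (take k xs) ⟩
  drop k xs ++ ys ++ take k xs                          ∎
  where
  open ≡-Reasoning
  |take|≡k : length (take k xs) ≡ k
  |take|≡k = trans (length-take k xs) (m≤n⇒m⊓n≡m k≤)

take-prefix : ∀ (xs ys : Str) → take (length xs) (xs ++ ys) ≡ xs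
take-prefix []       ys = refl
take-prefix (x ∷ xs) ys = cong (x ∷_) (take-prefix xs ys)

rotl-split : ∀ k w → k ≤ length w → iterate rotl w k ≡ drop k w ++ take k w
rotl-split k w k≤ = begin
  iterate rotl w k            ≡⟨ cong (λ v → iterate rotl v k) (sym (++-identityʳ w)) ⟩
  iterate rotl (w ++ []) k    ≡⟨ rotl-prefix k w [] k≤ ⟩
  drop k w ++ take k w        ∎
  where open ≡-Reasoning

rotl-iterate-↭ : ∀ w k → iterate rotl w k ↭ w
rotl-iterate-↭ w = iterate-preserves rotl {λ v → v ↭ w} (λ {y} y↭w → ↭-trans (rotl-↭ y) y↭w) ↭-refl

-- The shift σ on strings of length n: rotation by n ∸ s letters, so that the last
-- s letters of w are the first s letters of σ w; ρ (rotation by s) is its inverse.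
module Shift (n s : ℕ) (s≤n : s ≤ n) where

  σ : Str → Str
  σ w = iterate rotl w (n ∸ s)

  ρ : Str → Str
  ρ w = iterate rotl w s

  σ-↭ : ∀ w → σ w ↭ w
  σ-↭ w = rotl-iterate-↭ w (n ∸ s)

  σ-injective : ∀ {u v} → σ u ≡ σ v → u ≡ v
  σ-injective = iterate-injective rotl rotl-injective (n ∸ s)

  σ-overlap : ∀ {w} → length w ≡ n → Overlap n s w (σ w)
  σ-overlap {w} |w|≡n = sym (begin
    take s (σ w)                            ≡⟨ cong (take s) (rotl-split (n ∸ s) w t≤|w|) ⟩
    take s (drop (n ∸ s) w ++ take (n ∸ s) w) ≡⟨ cong (λ k → take k (drop (n ∸ s) w ++ take (n ∸ s) w)) (sym |drop|≡s) ⟩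
    take (length (drop (n ∸ s) w)) (drop (n ∸ s) w ++ take (n ∸ s) w) ≡⟨ take-prefix (drop (n ∸ s) w) _ ⟩
    drop (n ∸ s) w                          ∎)
    where
    open ≡-Reasoning
    t≤|w| : n ∸ s ≤ length w
    t≤|w| = subst (n ∸ s ≤_) (sym |w|≡n) (m∸n≤m n s)
    |drop|≡s : length (drop (n ∸ s) w) ≡ s
    |drop|≡s = trans (length-drop (n ∸ s) w) (trans (cong (_∸ (n ∸ s)) |w|≡n) (m∸[m∸n]≡n s≤n))

  σ-ρ : ∀ {w} → length w ≡ n → σ (ρ w) ≡ w
  σ-ρ {w} |w|≡n = begin
    iterate rotl (iterate rotl w s) (n ∸ s) ≡⟨ sym (iterate-+ rotl w s (n ∸ s)) ⟩
    iterate rotl w (s + (n ∸ s))            ≡⟨ cong (iterate rotl w) (trans (m+[n∸m]≡n s≤n) (sym |w|≡n)) ⟩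
    iterate rotl w (length w)               ≡⟨ rotl-length w ⟩
    w                                       ∎
    where open ≡-Reasoning

  -- σⁿ is the identity on words of length n, since σⁿ = rotl^((n ∸ s) n) = (rotlⁿ)^(n ∸ s).
  σ-order : ∀ {w} → length w ≡ n → iterate σ w n ≡ w
  σ-order {w} |w|≡n = begin
    iterate σ w n                               ≡⟨ iterate-* rotl w (n ∸ s) n ⟩
    iterate rotl w (n * (n ∸ s))                ≡⟨ cong (iterate rotl w) (*-comm n (n ∸ s)) ⟩
    iterate rotl w ((n ∸ s) * n)                ≡⟨ sym (iterate-* rotl w n (n ∸ s)) ⟩
    iterate (λ v → iterate rotl v n) w (n ∸ s)  ≡⟨ iterate-fixed (λ v → iterate rotl v n) rotl-n (n ∸ s) ⟩
    w                                           ∎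
    where
    open ≡-Reasoning
    rotl-n : iterate rotl w n ≡ w
    rotl-n = subst (λ k → iterate rotl w k ≡ w) |w|≡n (rotl-length w)

data Swap : Str → Str → Set where
  swap-at : ∀ Pr x y Q → Swap (Pr ++ x ∷ y ∷ Q) (Pr ++ y ∷ x ∷ Q)

swap-↭ : ∀ {u v} → Swap u v → v ↭ u
swap-↭ (swap-at Pr x y Q) = ++⁺ˡ Pr (↭-swap y x ↭-refl)

swaps-prepend : ∀ x {u v} → Star Swap u v → Star Swap (x ∷ u) (x ∷ v)
swaps-prepend x = gmap (x ∷_) λ { (swap-at Pr a b Q) → swap-at (x ∷ Pr) a b Q }

↭⇒swaps : ∀ {u v} → u ↭ v → Star Swap u v
↭⇒swaps ↭.refl              = ε
↭⇒swaps (↭.prep x p)        = swaps-prepend x (↭⇒swaps p)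
↭⇒swaps (↭.swap {xs} x y p) = swap-at [] x y xs ◅ swaps-prepend y (swaps-prepend x (↭⇒swaps p))
↭⇒swaps (↭.trans p q)       = ↭⇒swaps p ◅◅ ↭⇒swaps q

drop-swap : ∀ (Pr : Str) x y Q {k} → 2 + length Pr ≤ k → drop k (Pr ++ x ∷ y ∷ Q) ≡ drop k (Pr ++ y ∷ x ∷ Q)
drop-swap []       x y Q {suc (suc k)} _         = refl
drop-swap []       x y Q {suc zero}    (s≤s ())
drop-swap (p ∷ Pr) x y Q {suc k}       (s≤s 2+l≤k) = drop-swap Pr x y Q 2+l≤k

swap-position : ∀ (Pr : Str) x y Q → 2 + length Pr ≤ length (Pr ++ x ∷ y ∷ Q)
swap-position []       x y Q = s≤s (s≤s z≤n)
swap-position (p ∷ Pr) x y Q = s≤s (swap-position Pr x y Q)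

module Transposition (n s : ℕ) (2s<n : 2 * s < n) where

  s<n∸s : s < n ∸ s
  s<n∸s = m+n≤o⇒m≤o∸n (suc s) (subst (λ k → suc (s + k) ≤ n) (+-identityʳ s) 2s<n)

  s≤n : s ≤ n
  s≤n = m+n≤o⇒m≤o s (<⇒≤ 2s<n)

  open Shift n s s≤n public

  rotated-position : ∀ {l} → s ≤ l → 2 + l ≤ n → 2 + (l ∸ s) ≤ n ∸ s
  rotated-position {l} s≤l 2+l≤n = begin
    2 + (l ∸ s)    ≡⟨ +-∸-assoc 2 s≤l ⟨
    (2 + l) ∸ s    ≤⟨ ∸-monoˡ-≤ s 2+l≤n ⟩
    n ∸ s          ∎
    where open ≤-Reasoning

  swap-suffix : ∀ {u v} → length u ≡ n → Swap u v →
                drop (n ∸ s) u ≡ drop (n ∸ s) v ⊎ drop (n ∸ s) (ρ u) ≡ drop (n ∸ s) (ρ v)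
  swap-suffix |u|≡n (swap-at Pr x y Q) with 2 + length Pr ≤? n ∸ s
  ... | yes before = inj₁ (drop-swap Pr x y Q before)
  ... | no  inside = inj₂ (begin
    drop (n ∸ s) (ρ (Pr ++ x ∷ y ∷ Q))                 ≡⟨ cong (drop (n ∸ s)) (rotl-prefix s Pr _ s≤l) ⟩
    drop (n ∸ s) (drop s Pr ++ x ∷ y ∷ Q ++ take s Pr) ≡⟨ drop-swap (drop s Pr) x y (Q ++ take s Pr) rotated ⟩
    drop (n ∸ s) (drop s Pr ++ y ∷ x ∷ Q ++ take s Pr) ≡⟨ cong (drop (n ∸ s)) (rotl-prefix s Pr _ s≤l) ⟨
    drop (n ∸ s) (ρ (Pr ++ y ∷ x ∷ Q))                 ∎)
    where
    open ≡-Reasoning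
    -- the transposition reaches into the last s letters, hence (as s < n ∸ s) it
    -- lies beyond the first s letters
    s≤l : s ≤ length Pr
    s≤l = s≤s⁻¹ (<-≤-trans s<n∸s (s≤s⁻¹ (≰⇒> inside)))
    rotated : 2 + length (drop s Pr) ≤ n ∸ s
    rotated = subst (λ k → 2 + k ≤ n ∸ s) (sym (length-drop s Pr))
                (rotated-position s≤l (subst (2 + length Pr ≤_) |u|≡n (swap-position Pr x y Q)))

module Enumeration {A : Set} where

  inserts : A → List A → List (List A)
  inserts x []       = (x ∷ []) ∷ []
  inserts x (y ∷ ys) = (x ∷ y ∷ ys) ∷ map (y ∷_) (inserts x ys)

  permutations : List A → List (List A)
  permutations []       = [] ∷ []
  permutations (x ∷ xs) = concatMap (inserts x) (permutations xs)

  inserts-sound : ∀ x v {w} → w ∈ inserts x v → w ↭ x ∷ v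
  inserts-sound x []       (here refl) = ↭-refl
  inserts-sound x (y ∷ ys) (here refl) = ↭-refl
  inserts-sound x (y ∷ ys) (there w∈) with ∈-map⁻ (y ∷_) w∈
  ... | w′ , w′∈ , refl = ↭-trans (↭-prep y (inserts-sound x ys w′∈)) (↭-swap y x ↭-refl)

  inserts-complete : ∀ x ys zs → ys ++ x ∷ zs ∈ inserts x (ys ++ zs)
  inserts-complete x []       []       = here refl
  inserts-complete x []       (z ∷ zs) = here refl
  inserts-complete x (y ∷ ys) zs       = there (∈-map⁺ (y ∷_) (inserts-complete x ys zs))

  permutations-sound : ∀ m {w} → w ∈ permutations m → w ↭ m
  permutations-sound []       (here refl) = ↭-refl
  permutations-sound (x ∷ xs) w∈ with find (∈-concatMap⁻ (inserts x) {xs = permutations xs} w∈)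
  ... | v , v∈ , w∈inserts = ↭-trans (inserts-sound x v w∈inserts) (↭-prep x (permutations-sound xs v∈))

  permutations-complete : ∀ m {w} → w ↭ m → w ∈ permutations m
  permutations-complete [] w↭[] with ↭-empty-inv w↭[]
  ... | refl = here refl
  permutations-complete (x ∷ xs) w↭ with ∈-∃++ (∈-resp-↭ (↭-sym w↭) (here refl))
  ... | ys , zs , refl = ∈-concatMap⁺ (inserts x)
          (lose (permutations-complete xs (drop-mid ys [] w↭)) (inserts-complete x ys zs))

module Construction (n s : ℕ) (2s<n : 2 * s < n) (m : Str) (|m|≡n : length m ≡ n) where

  open Transposition n s 2s<n
  open Orbits (≡-dec ℕ._≟_) σ σ-injective
  open Enumeration

  R : Str → Str → Set
  R = Overlap n s

  length-↭ : ∀ {w} → w ↭ m → length w ≡ n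
  length-↭ w↭m = trans (↭-length w↭m) |m|≡n

  σ-length : ∀ {w} → length w ≡ n → length (σ w) ≡ n
  σ-length {w} |w|≡n = trans (↭-length (σ-↭ w)) |w|≡n

  n≡1+[n∸1] : suc (n ∸ 1) ≡ n
  n≡1+[n∸1] = m+[n∸m]≡n (≤-trans (s≤s z≤n) 2s<n)

  σ-power-ρ : ∀ {u} → length u ≡ n → iterate σ u (n ∸ 1) ≡ ρ u
  σ-power-ρ {u} |u|≡n = begin
    iterate σ u (n ∸ 1)          ≡⟨ cong (λ v → iterate σ v (n ∸ 1)) (σ-ρ |u|≡n) ⟨
    iterate σ (ρ u) (suc (n ∸ 1)) ≡⟨ cong (iterate σ (ρ u)) n≡1+[n∸1] ⟩
    iterate σ (ρ u) n            ≡⟨ σ-order (trans (↭-length (rotl-iterate-↭ u s)) |u|≡n) ⟩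
    ρ u                          ∎
    where open ≡-Reasoning

  orbit-of : ∀ {b} → b ↭ m → Orbit b
  orbit-of {b} b↭m = orbit (n ∸ 1) (trans (cong (iterate σ b) n≡1+[n∸1]) (σ-order (length-↭ b↭m)))

  record Admissible (cs : List Str) : Set where
    field
      unique : Unique cs
      sound  : ∀ {w} → w ∈ cs → w ↭ m
      closed : ∀ {w} → w ∈ cs → σ w ∈ cs

  admissible-↭ : ∀ {cs ds} → cs ↭ ds → Admissible cs → Admissible ds
  admissible-↭ cs↭ds A = record
    { unique = Unique-resp-↭ (setoid Str) (↭⇒↭ₛ cs↭ds) unique
    ; sound  = sound ∘ ∈-resp-↭ (↭-sym cs↭ds)
    ; closed = ∈-resp-↭ cs↭ds ∘ closed ∘ ∈-resp-↭ (↭-sym cs↭ds) }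
    where open Admissible A

  admissible-++ : ∀ {cs ds} → Admissible cs → Admissible ds → Disjoint cs ds → Admissible (cs ++ ds)
  admissible-++ {cs} {ds} A B disjoint = record
    { unique = Unique.++⁺ (Admissible.unique A) (Admissible.unique B) disjoint
    ; sound  = λ w∈ → [ Admissible.sound A , Admissible.sound B ] (∈-++⁻ cs w∈)
    ; closed = λ w∈ → [ ∈-++⁺ˡ ∘ Admissible.closed A , ∈-++⁺ʳ cs ∘ Admissible.closed B ] (∈-++⁻ cs w∈) }

  admissible-orbit : ∀ {b} (b↭m : b ↭ m) → Admissible (Orbit.elements (orbit-of b↭m))
  admissible-orbit b↭m = record
    { unique = unique ; sound = invariant (λ {y} y↭m → ↭-trans (σ-↭ y) y↭m) b↭m ; closed = closed }
    where open Orbit (orbit-of b↭m)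

  orbit-path : ∀ {b} (b↭m : b ↭ m) → Path R (σ b) (trajectory (Orbit.period (orbit-of b↭m)) (σ b)) b
  orbit-path b↭m = Orbit.path (orbit-of b↭m) {P = λ w → length w ≡ n} σ-length σ-overlap (length-↭ b↭m)

  closed-iterate : ∀ {cs} → Admissible cs → ∀ {w} → w ∈ cs → ∀ k → iterate σ w k ∈ cs
  closed-iterate {cs} A = iterate-preserves σ {_∈ cs} (Admissible.closed A)

  orbit-disjoint : ∀ {cs b} → Admissible cs → b ∉ cs → (b↭m : b ↭ m) →
                   Disjoint cs (Orbit.elements (orbit-of b↭m))
  orbit-disjoint A b∉ b↭m (w∈cs , w∈O) with Orbit.leads-back (orbit-of b↭m) w∈O
  ... | k , w↦b = b∉ (subst (_∈ _) w↦b (closed-iterate A w∈cs k))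

  record Cover : Set where
    field
      elements   : List Str
      admissible : Admissible elements
      linked     : CyclicallyLinked R elements
  open Cover

  initial : Cover
  initial = record
    { elements   = Orbit.elements (orbit-of ↭-refl)
    ; admissible = admissible-orbit ↭-refl
    ; linked     = cyc (path-close (orbit-path ↭-refl) (σ-overlap |m|≡n)) }

  m∈initial : m ∈ elements initial
  m∈initial = Orbit.x∈ (orbit-of ↭-refl)

  Extension : Cover → Str → Set
  Extension C w = ∃[ C′ ] (elements C ⊆ elements C′ × w ∈ elements C′)

  -- If a ∈ C and b ∉ C end with the same s letters, the orbit of b can be spliced
  -- into C right after a: b ends like a, so b's successor σ b may follow a, and
  -- a's old successor may follow b.
  absorb : ∀ C {a b} → a ∈ elements C → b ∉ elements C → b ↭ m →
           drop (n ∸ s) a ≡ drop (n ∸ s) b → Extension C b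
  absorb C@record { admissible = A ; linked = cyc {x} {xs} ch } a∈ b∉ b↭m same-end =
    C′ , ∈-resp-↭ (↭-sym merged) ∘ ∈-++⁺ˡ , ∈-resp-↭ (↭-sym merged) (∈-++⁺ʳ (x ∷ xs) (Orbit.x∈ O))
    where
    O = orbit-of b↭m
    |b|≡n = length-↭ b↭m
    spliced = splice ch a∈ (orbit-path b↭m)
                (trans same-end (σ-overlap |b|≡n)) (trans (sym same-end))
    ys′ = proj₁ spliced
    merged : x ∷ ys′ ↭ (x ∷ xs) ++ Orbit.elements O
    merged = ↭-prep x (proj₁ (proj₂ spliced))
    C′ : Cover
    C′ = record
      { elements   = x ∷ ys′
      ; admissible = admissible-↭ (↭-sym merged)
          (admissible-++ A (admissible-orbit b↭m) (orbit-disjoint A b∉ b↭m))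
      ; linked     = cyc (proj₂ (proj₂ spliced)) }

  absorb-swap : ∀ C {u v} → u ∈ elements C → Swap u v → Extension C v
  absorb-swap C {u} {v} u∈ sw = extend (v ∈? elements C) (swap-suffix |u|≡n sw)
    where
    open Admissible (admissible C)
    |u|≡n : length u ≡ n
    |u|≡n = length-↭ (sound u∈)
    v↭m : v ↭ m
    v↭m = ↭-trans (swap-↭ sw) (sound u∈)
    σρv≡v : σ (ρ v) ≡ v
    σρv≡v = σ-ρ (length-↭ v↭m)
    via-ρ : Extension C (ρ v) → Extension C v
    via-ρ (C′ , C⊆C′ , ρv∈) = C′ , C⊆C′ , subst (_∈ _) σρv≡v (Admissible.closed (admissible C′) ρv∈)
    extend : Dec (v ∈ elements C) → _ ⊎ _ → Extension C v
    extend (yes v∈) _               = C , ⊆-refl , v∈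
    extend (no v∉)  (inj₁ same-end) = absorb C u∈ v∉ v↭m same-end
    extend (no v∉)  (inj₂ same-end) = via-ρ (absorb C ρu∈ ρv∉ (↭-trans (rotl-iterate-↭ v s) v↭m) same-end)
      where
      ρu∈ : ρ u ∈ elements C
      ρu∈ = subst (_∈ _) (σ-power-ρ |u|≡n) (closed-iterate (admissible C) u∈ (n ∸ 1))
      ρv∉ : ρ v ∉ elements C
      ρv∉ ρv∈ = v∉ (subst (_∈ _) σρv≡v (closed ρv∈))

  absorb-swaps : ∀ C {u v} → u ∈ elements C → Star Swap u v → Extension C v
  absorb-swaps C u∈ ε = C , ⊆-refl , u∈
  absorb-swaps C u∈ (sw ◅ sws) with absorb-swap C u∈ sw
  ... | C₁ , C⊆C₁ , v∈ with absorb-swaps C₁ v∈ sws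
  ...   | C₂ , C₁⊆C₂ , w∈ = C₂ , ⊆-trans C⊆C₁ C₁⊆C₂ , w∈

  absorb-all : ∀ C → m ∈ elements C → ∀ ws → (∀ {w} → w ∈ ws → w ↭ m) →
               ∃[ C′ ] (elements C ⊆ elements C′ × ∀ {w} → w ∈ ws → w ∈ elements C′)
  absorb-all C m∈ []       _     = C , ⊆-refl , λ ()
  absorb-all C m∈ (w ∷ ws) sound with absorb-swaps C m∈ (↭⇒swaps (↭-sym (sound (here refl))))
  ... | C₁ , C⊆C₁ , w∈ with absorb-all C₁ (C⊆C₁ m∈) ws (sound ∘ there)
  ...   | C₂ , C₁⊆C₂ , ws⊆C₂ = C₂ , ⊆-trans C⊆C₁ C₁⊆C₂ , λ { (here refl) → C₁⊆C₂ w∈ ; (there v∈) → ws⊆C₂ v∈ }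

  complete-cover : ∃[ C ] (∀ {w} → w ↭ m → w ∈ elements C)
  complete-cover with absorb-all initial m∈initial (permutations m) (permutations-sound m)
  ... | C , _ , all∈C = C , all∈C ∘ permutations-complete m

  cover⇒ocycle : ∀ C → (∀ {w} → w ↭ m → w ∈ elements C) → IsOCycle n s (IsPermOf m) (elements C)
  cover⇒ocycle C complete = unique , (λ w → mk⇔ sound complete) , linked C
    where open Admissible (admissible C)

-- The theorem.
lemma2 : (n s : ℕ) → 1 ≤ s → 2 * s < n → (m : List ℕ) → length m ≡ n →
         Σ (List Str) (λ cs → IsOCycle n s (IsPermOf m) cs)
lemma2 n s _ 2s<n m |m|≡n = Cover.elements C , cover⇒ocycle C complete
  where
  open Construction n s 2s<n m |m|≡n
  C = proj₁ complete-cover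
  complete = proj₂ complete-cover
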